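{- Let $H$ be the graph with vertex set $\{a,b,c,d,e,f,g,h,z_1,z_2\}$ and edge set $\{ab, ac, ad, ae, af, ag, ah, az_1, az_2, bc, be, bh, bz_1, cd, ce, ch, de, dh, ef, eg, eh, ez_1, ez_2, fg, gh, gz_2, hz_1, hz_2, z_1z_2\}$. Call the edges $ab, de, ef, ch, gh$ heavy, and let $C$ be the cycle $abchgfeda$ of $H$. Then no extension of $C$ in $H$ contains every heavy edge.
   Context: If $C$ is a cycle of length $m$ in a graph $G$, an extension of $C$ is a cycle $C'$ of $G$ of length $m+1$ such that $V(C')\setminus V(C)$ consists of a single vertex (so $V(C)\subseteq V(C')$). -}

module Defs where

open import Data.Nat using (ℕ; _≤_; suc)
open import Data.List using (List; []; _∷_; _++_; [_]; length)
open import Data.List.Membership.Propositional using (_∈_; _∉_)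
open import Data.List.Relation.Unary.Unique.Propositional using (Unique)
open import Data.List.Relation.Unary.All using (All)
open import Data.Product using (_×_; _,_; ∃-syntax; proj₁; proj₂)
open import Data.Sum using (_⊎_)
open import Data.Unit using (⊤)
open import Data.Empty using (⊥)
open import Relation.Binary.PropositionalEquality using (_≡_)

data V : Set where
  a b c d e f g h z₁ z₂ : V

E : List (V × V)
E = (a , b) ∷ (a , c) ∷ (a , d) ∷ (a , e) ∷ (a , f) ∷ (a , g) ∷ (a , h) ∷ (a , z₁) ∷ (a , z₂)
  ∷ (b , c) ∷ (b , e) ∷ (b , h) ∷ (b , z₁)
  ∷ (c , d) ∷ (c , e) ∷ (c , h)
  ∷ (d , e) ∷ (d , h)
  ∷ (e , f) ∷ (e , g) ∷ (e , h) ∷ (e , z₁) ∷ (e , z₂)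
  ∷ (f , g) ∷ (g , h) ∷ (g , z₂) ∷ (h , z₁) ∷ (h , z₂) ∷ (z₁ , z₂) ∷ []

Adj : V → V → Set
Adj u v = ((u , v) ∈ E) ⊎ ((v , u) ∈ E)

Chain : List V → Set
Chain [] = ⊤
Chain (x ∷ []) = ⊤
Chain (x ∷ y ∷ r) = Adj x y × Chain (y ∷ r)

close : List V → List V
close [] = []
close (x ∷ r) = x ∷ r ++ [ x ]

-- A cycle of H, given by its cyclic vertex sequence v₀ v₁ … v_{m-1}:
-- at least 3 vertices, all distinct, consecutive (cyclically) vertices adjacent.
-- Its length is the number of vertices (= number of edges).
IsCycle : List V → Set
IsCycle vs = (3 ≤ length vs) × Unique vs × Chain (close vs)

InChain : V → V → List V → Set
InChain u v [] = ⊥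
InChain u v (x ∷ []) = ⊥
InChain u v (x ∷ y ∷ r) = ((x ≡ u × y ≡ v) ⊎ (x ≡ v × y ≡ u)) ⊎ InChain u v (y ∷ r)

CycleEdge : List V → V → V → Set
CycleEdge vs u v = InChain u v (close vs)

IsExtension : List V → List V → Set
IsExtension C C' =
  IsCycle C' × (length C' ≡ suc (length C)) × (∀ x → x ∈ C → x ∈ C')
  × (∃[ w ] ((w ∈ C') × (w ∉ C) × (∀ x → x ∈ C' → x ∉ C → x ≡ w)))

Cyc : List V
Cyc = a ∷ b ∷ c ∷ h ∷ g ∷ f ∷ e ∷ d ∷ []

Heavy : List (V × V)
Heavy = (a , b) ∷ (d , e) ∷ (e , f) ∷ (c , h) ∷ (g , h) ∷ []

ContainsAllHeavy : List V → Set
ContainsAllHeavy C' = All (λ p → CycleEdge C' (proj₁ p) (proj₂ p)) Heavy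

module Submission where

-- C' has the nine vertices of C plus one extra vertex w, and w is z₁
-- or z₂ since those are the only vertices of H outside C.  A cyclic vertex
-- sequence can be rotated without changing the cycle, so we may assume that
-- C' is written as q ++ [ a ], i.e. that it is a path on 9 vertices of the
-- vertex set w ∷ Cyc which starts at a and is then closed up.  All such
-- paths are enumerated by a breadth-first search that only extends a path
-- by an unused neighbour of its newest vertex; the enumeration is proved
-- complete, and a decision procedure then checks that none of the
-- enumerated paths closes into a cycle using all five heavy edges.

open import Defs
open import Data.List using (List; []; _∷_; _++_; [_]; length; map; concatMap; filter)
open import Data.List.Properties using (++-assoc; length-++)
open import Data.List.Membership.Propositional using (_∈_; _∉_; lose)
open import Data.List.Membership.Propositional.Properties using (∈-map⁺; ∈-concatMap⁺; ∈-filter⁺; ∈-∃++; ∈-++⁺ˡ; ∈-++⁻)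
import Data.List.Membership.DecPropositional as DecMembership
open import Data.List.Relation.Binary.Subset.Propositional using (_⊆_)
open import Data.List.Relation.Unary.All as All using (All; []; _∷_; all?)
open import Data.List.Relation.Unary.Any using (here; there)
open import Data.List.Relation.Unary.AllPairs using ([]; _∷_)
open import Data.List.Relation.Unary.Unique.Propositional using (Unique)
open import Data.List.Relation.Unary.Unique.Propositional.Properties using (++⁺; Unique[x∷xs]⇒x∉xs)
open import Data.Nat using (ℕ; zero; suc)
import Data.Nat.Properties as ℕ
open import Data.Product using (_×_; _,_; proj₁; proj₂)
open import Data.Product.Properties using (≡-dec)
open import Data.Sum using (_⊎_; inj₁; inj₂)
open import Data.Unit using (tt)
open import Function using (_∘_)
open import Relation.Binary.Definitions using (DecidableEquality)
open import Relation.Binary.PropositionalEquality using (_≡_; refl; sym; trans; cong; subst; module ≡-Reasoning)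
open import Relation.Nullary using (¬_; Dec; yes; no; ¬?; contradiction)
open import Relation.Nullary.Decidable using (map′; _×-dec_; _⊎-dec_; _→-dec_; toWitness)

code : V → ℕ
code a = 0
code b = 1
code c = 2
code d = 3
code e = 4
code f = 5
code g = 6
code h = 7
code z₁ = 8
code z₂ = 9

decode : ℕ → V
decode 0 = a
decode 1 = b
decode 2 = c
decode 3 = d
decode 4 = e
decode 5 = f
decode 6 = g
decode 7 = h
decode 8 = z₁
decode _ = z₂

decode-code : ∀ v → decode (code v) ≡ v
decode-code a = refl
decode-code b = refl
decode-code c = refl
decode-code d = refl
decode-code e = refl
decode-code f = refl
decode-code g = refl
decode-code h = refl
decode-code z₁ = refl
decode-code z₂ = refl

code-injective : ∀ {v w} → code v ≡ code w → v ≡ w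
code-injective {v} {w} eq = begin
  v                ≡⟨ sym (decode-code v) ⟩
  decode (code v)  ≡⟨ cong decode eq ⟩
  decode (code w)  ≡⟨ decode-code w ⟩
  w                ∎
  where open ≡-Reasoning

_≟_ : DecidableEquality V
v ≟ w = map′ code-injective (cong code) (code v ℕ.≟ code w)

open DecMembership _≟_ using (_∈?_)

adj? : ∀ u v → Dec (Adj u v)
adj? u v = edge? (u , v) ⊎-dec edge? (v , u)
  where edge? = λ uv → DecMembership._∈?_ (≡-dec _≟_ _≟_) uv E

-- The vertex list of H and its adjacency lists.  Searching paths through
-- the adjacency lists is much cheaper than through the edge list.

vertices : List V
vertices = a ∷ b ∷ c ∷ d ∷ e ∷ f ∷ g ∷ h ∷ z₁ ∷ z₂ ∷ []

∈-vertices : ∀ v → v ∈ vertices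
∈-vertices a = here refl
∈-vertices b = there (here refl)
∈-vertices c = there (there (here refl))
∈-vertices d = there (there (there (here refl)))
∈-vertices e = there (there (there (there (here refl))))
∈-vertices f = there (there (there (there (there (here refl)))))
∈-vertices g = there (there (there (there (there (there (here refl))))))
∈-vertices h = there (there (there (there (there (there (there (here refl)))))))
∈-vertices z₁ = there (there (there (there (there (there (there (there (here refl))))))))
∈-vertices z₂ = there (there (there (there (there (there (there (there (there (here refl)))))))))

neighbours : V → List V
neighbours a = b ∷ c ∷ d ∷ e ∷ f ∷ g ∷ h ∷ z₁ ∷ z₂ ∷ []
neighbours b = a ∷ c ∷ e ∷ h ∷ z₁ ∷ []
neighbours c = a ∷ b ∷ d ∷ e ∷ h ∷ []
neighbours d = a ∷ c ∷ e ∷ h ∷ []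
neighbours e = a ∷ b ∷ c ∷ d ∷ f ∷ g ∷ h ∷ z₁ ∷ z₂ ∷ []
neighbours f = a ∷ e ∷ g ∷ []
neighbours g = a ∷ e ∷ f ∷ h ∷ z₂ ∷ []
neighbours h = a ∷ b ∷ c ∷ d ∷ e ∷ g ∷ z₁ ∷ z₂ ∷ []
neighbours z₁ = a ∷ b ∷ e ∷ h ∷ z₂ ∷ []
neighbours z₂ = a ∷ e ∷ g ∷ h ∷ z₁ ∷ []

neighbours-complete : ∀ {u v} → Adj u v → u ∈ neighbours v
neighbours-complete {u} {v} uv =
  All.lookup (All.lookup table (∈-vertices v)) (∈-vertices u) uv
  where
  table : All (λ v → All (λ u → Adj u v → u ∈ neighbours v) vertices) vertices
  table = toWitness {a? = all? (λ v → all? (λ u → adj? u v →-dec u ∈? neighbours v) vertices) vertices} tt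

chain? : ∀ p → Dec (Chain p)
chain? [] = yes tt
chain? (x ∷ []) = yes tt
chain? (x ∷ y ∷ r) = adj? x y ×-dec chain? (y ∷ r)

inChain? : ∀ u v p → Dec (InChain u v p)
inChain? u v [] = no λ ()
inChain? u v (x ∷ []) = no λ ()
inChain? u v (x ∷ y ∷ r) =
  (((x ≟ u) ×-dec (y ≟ v)) ⊎-dec ((x ≟ v) ×-dec (y ≟ u))) ⊎-dec inChain? u v (y ∷ r)

heavy? : ∀ p → Dec (ContainsAllHeavy p)
heavy? p = all? (λ uv → inChain? (proj₁ uv) (proj₂ uv) (close p)) Heavy

chain-prefix : ∀ l m → Chain (l ++ m) → Chain l
chain-prefix [] m _ = tt
chain-prefix (x ∷ []) m _ = tt
chain-prefix (x ∷ y ∷ r) m (xy , ch) = xy , chain-prefix (y ∷ r) m ch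

chain-unclose : ∀ L → Chain (close L) → Chain L
chain-unclose [] _ = tt
chain-unclose (x ∷ r) = chain-prefix (x ∷ r) [ x ]

rotate : {A : Set} → List A → List A
rotate [] = []
rotate (x ∷ r) = r ++ [ x ]

rotate-to-end : {A : Set} (P : List A → Set) → (∀ {L} → P L → P (rotate L))
              → ∀ xs (s : A) ys → P (xs ++ s ∷ ys) → P (ys ++ xs ++ [ s ])
rotate-to-end P rot [] s ys p = rot p
rotate-to-end P rot (x ∷ xs) s ys p =
  subst P (++-assoc ys [ x ] (xs ++ [ s ]))
    (rotate-to-end P rot xs s (ys ++ [ x ]) (subst P (++-assoc xs (s ∷ ys) [ x ]) (rot p)))

length-rotate : {A : Set} (L : List A) → length (rotate L) ≡ length L
length-rotate [] = refl
length-rotate (x ∷ r) = trans (length-++ r) (ℕ.+-comm (length r) 1)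

unique-rotate : {A : Set} (L : List A) → Unique L → Unique (rotate L)
unique-rotate [] u = u
unique-rotate (x ∷ r) u@(_ ∷ r-unique) =
  ++⁺ r-unique ([] ∷ []) λ { (y∈r , here refl) → Unique[x∷xs]⇒x∉xs u y∈r }

rotate-⊆ : {A : Set} (L : List A) → rotate L ⊆ L
rotate-⊆ (x ∷ r) y∈ with ∈-++⁻ r y∈
... | inj₁ y∈r = there y∈r
... | inj₂ (here refl) = here refl

chain-snoc : ∀ y r x z → Chain (y ∷ r ++ [ x ]) → Adj x z → Chain (y ∷ (r ++ [ x ]) ++ [ z ])
chain-snoc y [] x z (yx , _) xz = yx , xz , tt
chain-snoc y (s ∷ r) x z (ys , ch) xz = ys , chain-snoc s r x z ch xz

chain-rotate : ∀ L → Chain (close L) → Chain (close (rotate L))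
chain-rotate [] ch = ch
chain-rotate (x ∷ []) ch = ch
chain-rotate (x ∷ y ∷ r) (xy , ch) = chain-snoc y r x y ch xy

SameEdge : V → V → V → V → Set
SameEdge u v x z = (x ≡ u × z ≡ v) ⊎ (x ≡ v × z ≡ u)

inChain-++ : ∀ {u v} l m → InChain u v l → InChain u v (l ++ m)
inChain-++ (x ∷ y ∷ r) m (inj₁ uv) = inj₁ uv
inChain-++ (x ∷ y ∷ r) m (inj₂ p) = inj₂ (inChain-++ (y ∷ r) m p)

inChain-last : ∀ {u v} y r x z → SameEdge u v x z → InChain u v (y ∷ (r ++ [ x ]) ++ [ z ])
inChain-last y [] x z xz = inj₂ (inj₁ xz)
inChain-last y (s ∷ r) x z xz = inj₂ (inChain-last s r x z xz)

inChain-rotate : ∀ {u v} L → InChain u v (close L) → InChain u v (close (rotate L))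
inChain-rotate (x ∷ []) p = p
inChain-rotate (x ∷ y ∷ r) (inj₁ xy) = inChain-last y r x y xy
inChain-rotate (x ∷ y ∷ r) (inj₂ p) = inChain-++ (y ∷ r ++ [ x ]) [ y ] p

record HeavyCycleIn (U L : List V) : Set where
  field
    closed   : Chain (close L)
    distinct : Unique L
    within   : L ⊆ U
    heavy    : ContainsAllHeavy L

heavyCycle-rotate : ∀ {U} L → HeavyCycleIn U L → HeavyCycleIn U (rotate L)
heavyCycle-rotate L C = record
  { closed   = chain-rotate L closed
  ; distinct = unique-rotate L distinct
  ; within   = within ∘ rotate-⊆ L
  ; heavy    = All.map (inChain-rotate L) heavy
  }
  where open HeavyCycleIn C

-- Simple paths with vertices in U, starting at s, grown at the front: a
-- path y ∷ p is extended by every neighbour x of y in U not yet visited.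
module PathsFrom (U : List V) (s : V) where

  extensions : List V → List (List V)
  extensions [] = []
  extensions (y ∷ p) =
    map (_∷ y ∷ p) (filter (λ x → x ∈? U ×-dec ¬? (x ∈? y ∷ p)) (neighbours y))

  -- all such paths with n + 1 vertices
  paths : ℕ → List (List V)
  paths zero = [ [ s ] ]
  paths (suc n) = concatMap extensions (paths n)

  extend : ∀ n x y p → y ∷ p ∈ paths n → Adj x y → x ∉ y ∷ p → x ∈ U
         → x ∷ y ∷ p ∈ paths (suc n)
  extend n x y p yp∈ xy x∉ x∈U =
    ∈-concatMap⁺ extensions (lose yp∈
      (∈-map⁺ (_∷ y ∷ p) (∈-filter⁺ (λ x → x ∈? U ×-dec ¬? (x ∈? y ∷ p)) (neighbours-complete xy) (x∈U , x∉))))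

  paths-complete : ∀ q → Chain (q ++ [ s ]) → Unique (q ++ [ s ]) → q ⊆ U
                 → q ++ [ s ] ∈ paths (length q)
  paths-complete [] _ _ _ = here refl
  paths-complete (x ∷ []) (xs , _) u q⊆U =
    extend 0 x s [] (here refl) xs (Unique[x∷xs]⇒x∉xs u) (q⊆U (here refl))
  paths-complete (x ∷ y ∷ q) (xy , ch) u@(_ ∷ u′) q⊆U =
    extend (length (y ∷ q)) x y (q ++ [ s ]) (paths-complete (y ∷ q) ch u′ (q⊆U ∘ there)) xy (Unique[x∷xs]⇒x∉xs u) (q⊆U (here refl))

ClosesHeavily : List V → Set
ClosesHeavily p = Chain (close p) × ContainsAllHeavy p

closesHeavily? : ∀ p → Dec (ClosesHeavily p)
closesHeavily? p = chain? (close p) ×-dec heavy? p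

exhaustive-search : All (λ w → All (¬_ ∘ ClosesHeavily) (PathsFrom.paths (w ∷ Cyc) a 8)) (z₁ ∷ z₂ ∷ [])
exhaustive-search =
  toWitness {a? = all? (λ w → all? (¬? ∘ closesHeavily?) (PathsFrom.paths (w ∷ Cyc) a 8)) (z₁ ∷ z₂ ∷ [])} tt

no-heavy-cycle : ∀ {w} → w ∈ z₁ ∷ z₂ ∷ [] → ∀ q → length (q ++ [ a ]) ≡ 9
               → ¬ HeavyCycleIn (w ∷ Cyc) (q ++ [ a ])
no-heavy-cycle {w} w∈ q len C =
  All.lookup (All.lookup exhaustive-search w∈) enumerated (closed , heavy)
  where
  open HeavyCycleIn C
  length-q : length q ≡ 8
  length-q = ℕ.+-cancelʳ-≡ 1 (length q) 8 (trans (sym (length-++ q)) len)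
  enumerated : q ++ [ a ] ∈ PathsFrom.paths (w ∷ Cyc) a 8
  enumerated = subst (λ n → q ++ [ a ] ∈ PathsFrom.paths (w ∷ Cyc) a n) length-q
    (PathsFrom.paths-complete (w ∷ Cyc) a q (chain-unclose (q ++ [ a ]) closed) distinct (within ∘ ∈-++⁺ˡ))

outside-Cyc : ∀ w → w ∉ Cyc → w ∈ z₁ ∷ z₂ ∷ []
outside-Cyc a w∉ = contradiction (here refl) w∉
outside-Cyc b w∉ = contradiction (there (here refl)) w∉
outside-Cyc c w∉ = contradiction (there (there (here refl))) w∉
outside-Cyc h w∉ = contradiction (there (there (there (here refl)))) w∉
outside-Cyc g w∉ = contradiction (there (there (there (there (here refl))))) w∉
outside-Cyc f w∉ = contradiction (there (there (there (there (there (here refl)))))) w∉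
outside-Cyc e w∉ = contradiction (there (there (there (there (there (there (here refl))))))) w∉
outside-Cyc d w∉ = contradiction (there (there (there (there (there (there (there (here refl)))))))) w∉
outside-Cyc z₁ _ = here refl
outside-Cyc z₂ _ = there (here refl)

within-extension : ∀ (C C' : List V) w → (∀ x → x ∈ C' → x ∉ C → x ≡ w) → C' ⊆ w ∷ C
within-extension C C' w only {x} x∈C' with x ∈? C
... | yes x∈C = there x∈C
... | no x∉C = here (only x x∈C' x∉C)

lemma2p1 : (C' : List V) → IsExtension Cyc C' → ¬ ContainsAllHeavy C'
lemma2p1 C' ((_ , distinct , closed) , len , Cyc⊆C' , w , _ , w∉Cyc , only) heavy
  with xs , ys , refl ← ∈-∃++ (Cyc⊆C' a (here refl)) =
  no-heavy-cycle (outside-Cyc w w∉Cyc) (ys ++ xs) (proj₂ rotated) (proj₁ rotated)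
  where
  -- being a heavy 9-cycle in w ∷ Cyc is invariant under rotation
  HeavyNineCycle : List V → Set
  HeavyNineCycle L = HeavyCycleIn (w ∷ Cyc) L × length L ≡ 9

  C′-heavy : HeavyNineCycle (xs ++ a ∷ ys)
  C′-heavy = record { closed = closed ; distinct = distinct
                    ; within = within-extension Cyc (xs ++ a ∷ ys) w only ; heavy = heavy } , len

  rotated : HeavyNineCycle ((ys ++ xs) ++ [ a ])
  rotated = subst HeavyNineCycle (sym (++-assoc ys xs [ a ]))
    (rotate-to-end HeavyNineCycle (λ {L} (C , n) → heavyCycle-rotate L C , trans (length-rotate L) n) xs a ys C′-heavy)
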